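{- Let $k\ge0$ be an integer and $s\in[[0,2^k-1]]$. Then for every $i\in[[0,\mathrm{last}_{k,s}]]$, $X_{k,s,i}=\{\mathrm{rev}_k(t_{k,s,i})+2^{k-l_{k,s,i}}\cdot x' : x'\in[[0,2^{l_{k,s,i}}-1]]\}$ and $\mathrm{rev}_k(t_{k,s,i})<2^{k-l_{k,s,i}}$.
   Context: $[[a,b]]=\{x\in\mathbb{Z}: a\le x\le b\}$, $n=2^k$. For $x=\sum_{i=0}^{k-1}x_i2^i\in[[0,2^k-1]]$, $\mathrm{rev}_k(x)=\sum_{i=0}^{k-1}x_i2^{k-1-i}$, and for $S\subseteq[[0,2^k-1]]$, $\mathrm{rev}_k S=\{\mathrm{rev}_k(x):x\in S\}$. Define $t_{k,s,0}=s$, $l_{k,s,i}=\max\{l\le k : t_{k,s,i}\bmod 2^l=0\}$ (with $l\ge 0$), and $t_{k,s,i+1}=(t_{k,s,i}+2^{l_{k,s,i}})\bmod n$ for $i\ge0$. Let $\mathrm{last}_{k,s}=\min\{i\ge0 : t_{k,s,i}=0\}$. For $0\le i\le\mathrm{last}_{k,s}$ let $Y_{k,s,i}=[[t_{k,s,i},\,t_{k,s,i}+2^{l_{k,s,i}}-1]]$ (so $Y_{k,s,\mathrm{last}_{k,s}}=[[0,2^k-1]]$) and $X_{k,s,i}=\mathrm{rev}_k Y_{k,s,i}$. -}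

module Defs where

open import Data.Nat using (ℕ; zero; suc; _+_; _*_; _∸_; _^_; _≤_; _<_; NonZero)
open import Data.Nat.DivMod using (_/_; _%_)
open import Data.Nat.Properties using (_≟_; m^n≢0)
open import Data.Product using (Σ; _×_; ∃)
open import Data.Bool using (if_then_else_)
open import Relation.Nullary.Decidable using (⌊_⌋)
open import Relation.Binary.PropositionalEquality using (_≡_; _≢_)

mod2^ : ℕ → ℕ → ℕ
mod2^ x e = _%_ x (2 ^ e) {{m^n≢0 2 e}}

div2^ : ℕ → ℕ → ℕ
div2^ x e = _/_ x (2 ^ e) {{m^n≢0 2 e}}

bit : ℕ → ℕ → ℕ
bit i x = div2^ x i % 2

sumTo : ℕ → (ℕ → ℕ) → ℕ
sumTo zero    f = 0
sumTo (suc m) f = sumTo m f + f m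

rev : ℕ → ℕ → ℕ
rev k x = sumTo k (λ i → bit i x * 2 ^ (k ∸ 1 ∸ i))

maxDiv : ℕ → ℕ → ℕ
maxDiv zero    t = 0
maxDiv (suc b) t = if ⌊ mod2^ t (suc b) ≟ 0 ⌋ then suc b else maxDiv b t

mutual
  tt : ℕ → ℕ → ℕ → ℕ
  tt k s zero    = s
  tt k s (suc i) = mod2^ (tt k s i + 2 ^ ll k s i) k

  ll : ℕ → ℕ → ℕ → ℕ
  ll k s i = maxDiv k (tt k s i)

IsLast : ℕ → ℕ → ℕ → Set
IsLast k s m = (tt k s m ≡ 0) × (∀ j → j < m → tt k s j ≢ 0)

InY : ℕ → ℕ → ℕ → ℕ → Set
InY k s i x = (tt k s i ≤ x) × (x ≤ tt k s i + 2 ^ ll k s i ∸ 1)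

InX : ℕ → ℕ → ℕ → ℕ → Set
InX k s i y = Σ ℕ (λ x → InY k s i x × rev k x ≡ y)

-- Write t = q·2^l with l ≤ k. Adding r < 2^l to t only touches the low l bits, which
-- rev_k sends to the top l positions: rev_k(q·2^l + r) = rev_{k-l}(q) + 2^(k-l)·rev_l(r).
-- Taking r = 0 gives rev_k(t) = rev_{k-l}(q) < 2^(k-l), and since rev_l is an involution
-- of [[0, 2^l - 1]], the image of [[t, t + 2^l - 1]] is the progression rev_k(t) + 2^(k-l)·x′.
module Submission where

open import Defs
open import Data.Nat using (ℕ; zero; suc; _+_; _*_; _∸_; _^_; _≤_; _<_; z≤n; s≤s; pred; NonZero)
open import Data.Nat.Properties
open import Data.Nat.DivMod
open import Data.Nat.Divisibility using (_∣_; divides; m%n≡0⇒n∣m)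
open import Data.Nat.Tactic.RingSolver using (solve-∀)
open import Data.Product using (Σ; _×_; _,_)
open import Relation.Nullary using (yes; no)
open import Function.Bundles using (_⇔_; mk⇔)
open import Relation.Binary.PropositionalEquality

rev′ : ℕ → ℕ → ℕ
rev′ zero    x = 0
rev′ (suc k) x = x % 2 * 2 ^ k + rev′ k (x / 2)

sumTo-cong : ∀ m {f g : ℕ → ℕ} → (∀ i → f i ≡ g i) → sumTo m f ≡ sumTo m g
sumTo-cong zero    f≗g = refl
sumTo-cong (suc m) f≗g = cong₂ _+_ (sumTo-cong m f≗g) (f≗g m)

sumTo-suc : ∀ m (f : ℕ → ℕ) → sumTo (suc m) f ≡ f 0 + sumTo m (λ i → f (suc i))
sumTo-suc zero    f = +-comm 0 (f 0)
sumTo-suc (suc m) f = begin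
  sumTo (suc m) f + f (suc m)                   ≡⟨ cong (_+ f (suc m)) (sumTo-suc m f) ⟩
  f 0 + sumTo m (λ i → f (suc i)) + f (suc m)   ≡⟨ +-assoc (f 0) _ _ ⟩
  f 0 + (sumTo m (λ i → f (suc i)) + f (suc m)) ∎
  where open ≡-Reasoning

bit-zero : ∀ x → bit 0 x ≡ x % 2
bit-zero x = cong (_% 2) (n/1≡n x)

bit-suc : ∀ i x → bit (suc i) x ≡ bit i (x / 2)
bit-suc i x = cong (_% 2) (sym (m/n/o≡m/[n*o] x 2 (2 ^ i) {{_}} {{m^n≢0 2 i}} {{m^n≢0 2 (suc i)}}))

rev≡rev′ : ∀ k x → rev k x ≡ rev′ k x
rev≡rev′ zero    x = refl
rev≡rev′ (suc k) x = begin
  rev (suc k) x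
    ≡⟨ sumTo-suc k (λ i → bit i x * 2 ^ (k ∸ i)) ⟩
  bit 0 x * 2 ^ k + sumTo k (λ i → bit (suc i) x * 2 ^ (k ∸ suc i))
    ≡⟨ cong₂ _+_ (cong (_* 2 ^ k) (bit-zero x))
                 (sumTo-cong k (λ i → cong₂ _*_ (bit-suc i x) (cong (2 ^_) (sym (∸-+-assoc k 1 i))))) ⟩
  x % 2 * 2 ^ k + rev k (x / 2)
    ≡⟨ cong (x % 2 * 2 ^ k +_) (rev≡rev′ k (x / 2)) ⟩
  rev′ (suc k) x ∎
  where open ≡-Reasoning

rev′<2^ : ∀ k x → rev′ k x < 2 ^ k
rev′<2^ zero    x = s≤s z≤n
rev′<2^ (suc k) x = begin-strict
  x % 2 * 2 ^ k + rev′ k (x / 2) <⟨ +-monoʳ-< (x % 2 * 2 ^ k) (rev′<2^ k (x / 2)) ⟩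
  x % 2 * 2 ^ k + 2 ^ k          ≤⟨ +-monoˡ-≤ (2 ^ k) (*-monoˡ-≤ (2 ^ k) (≤-pred (m%n<n x 2))) ⟩
  1 * 2 ^ k + 2 ^ k              ≡⟨ cong (_+ 2 ^ k) (*-identityˡ (2 ^ k)) ⟩
  2 ^ k + 2 ^ k                  ≡⟨ cong (2 ^ k +_) (sym (+-identityʳ (2 ^ k))) ⟩
  2 ^ suc k                      ∎
  where open ≤-Reasoning

rev′-bit-cons : ∀ k {b} a → b < 2 → rev′ (suc k) (b + a * 2) ≡ b * 2 ^ k + rev′ k a
rev′-bit-cons k {b} a b<2 = cong₂ _+_ (cong (_* 2 ^ k) b%2≡b) (cong (rev′ k) [b+a*2]/2≡a)
  where
  open ≡-Reasoning
  b%2≡b : (b + a * 2) % 2 ≡ b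
  b%2≡b = trans ([m+kn]%n≡m%n b a 2) (m<n⇒m%n≡m b<2)
  [b+a*2]/2≡a : (b + a * 2) / 2 ≡ a
  [b+a*2]/2≡a = begin
    (b + a * 2) / 2       ≡⟨ +-distrib-/ b (a * 2) no-carry ⟩
    b / 2 + a * 2 / 2     ≡⟨ cong₂ _+_ (m<n⇒m/n≡0 b<2) (m*n/n≡m a 2) ⟩
    a                     ∎
    where
    no-carry : b % 2 + a * 2 % 2 < 2
    no-carry = subst (λ c → b % 2 + c < 2) (sym ([m+kn]%n≡m%n 0 a 2))
                 (subst (_< 2) (sym (+-identityʳ (b % 2))) (m%n<n b 2))

m<2^1+n⇒m/2<2^n : ∀ n {m} → m < 2 ^ suc n → m / 2 < 2 ^ n
m<2^1+n⇒m/2<2^n n {m} m<2^1+n = m<n*o⇒m/o<n (subst (m <_) (*-comm 2 (2 ^ n)) m<2^1+n)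

rev′-zero : ∀ k → rev′ k 0 ≡ 0
rev′-zero zero    = refl
rev′-zero (suc k) = rev′-zero k

rev′-split : ∀ l j q {r} → r < 2 ^ l → rev′ (l + j) (q * 2 ^ l + r) ≡ rev′ j q + 2 ^ j * rev′ l r
rev′-split zero    j q {zero} _ = begin
  rev′ j (q * 1 + 0)    ≡⟨ cong (rev′ j) (trans (+-identityʳ _) (*-identityʳ q)) ⟩
  rev′ j q              ≡⟨ sym (+-identityʳ _) ⟩
  rev′ j q + 0          ≡⟨ cong (rev′ j q +_) (sym (*-zeroʳ (2 ^ j))) ⟩
  rev′ j q + 2 ^ j * 0  ∎
  where open ≡-Reasoning
rev′-split zero    j q {suc r} (s≤s ())
rev′-split (suc l) j q {r} r<2^1+l = begin
  rev′ (suc l + j) (q * 2 ^ suc l + r)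
    ≡⟨ cong (rev′ (suc (l + j))) regroup ⟩
  rev′ (suc (l + j)) (b + (q * 2 ^ l + a) * 2)
    ≡⟨ rev′-bit-cons (l + j) _ b<2 ⟩
  b * 2 ^ (l + j) + rev′ (l + j) (q * 2 ^ l + a)
    ≡⟨ cong₂ _+_ (cong (b *_) (^-distribˡ-+-* 2 l j)) (rev′-split l j q (m<2^1+n⇒m/2<2^n l r<2^1+l)) ⟩
  b * (2 ^ l * 2 ^ j) + (rev′ j q + 2 ^ j * rev′ l a)
    ≡⟨ factor-2^j b (2 ^ l) (2 ^ j) (rev′ j q) (rev′ l a) ⟩
  rev′ j q + 2 ^ j * rev′ (suc l) r ∎
  where
  open ≡-Reasoning
  shift-digit : ∀ q p b a → q * (p * 2) + (b + a * 2) ≡ b + (q * p + a) * 2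
  shift-digit = solve-∀
  factor-2^j : ∀ b p p′ u v → b * (p * p′) + (u + p′ * v) ≡ u + p′ * (b * p + v)
  factor-2^j = solve-∀
  b = r % 2
  a = r / 2
  b<2 : b < 2
  b<2 = m%n<n r 2
  regroup : q * 2 ^ suc l + r ≡ b + (q * 2 ^ l + a) * 2
  regroup = begin
    q * 2 ^ suc l + r              ≡⟨ cong₂ _+_ (cong (q *_) (*-comm 2 (2 ^ l))) (m≡m%n+[m/n]*n r 2) ⟩
    q * (2 ^ l * 2) + (b + a * 2)  ≡⟨ shift-digit q (2 ^ l) b a ⟩
    b + (q * 2 ^ l + a) * 2        ∎

rev′-involutive : ∀ k {x} → x < 2 ^ k → rev′ k (rev′ k x) ≡ x
rev′-involutive zero    {zero} _ = refl
rev′-involutive zero    {suc x} (s≤s ())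
rev′-involutive (suc k) {x} x<2^1+k = begin
  rev′ (suc k) (x % 2 * 2 ^ k + rev′ k (x / 2))
    ≡⟨ cong (λ n → rev′ n (x % 2 * 2 ^ k + rev′ k (x / 2))) (+-comm 1 k) ⟩
  rev′ (k + 1) (x % 2 * 2 ^ k + rev′ k (x / 2))
    ≡⟨ rev′-split k 1 (x % 2) (rev′<2^ k (x / 2)) ⟩
  rev′ 1 (x % 2) + 2 ^ 1 * rev′ k (rev′ k (x / 2))
    ≡⟨ cong₂ _+_ rev′-1-bit (cong (2 ^ 1 *_) (rev′-involutive k (m<2^1+n⇒m/2<2^n k x<2^1+k))) ⟩
  x % 2 + 2 * (x / 2)
    ≡⟨ cong (x % 2 +_) (*-comm 2 (x / 2)) ⟩
  x % 2 + x / 2 * 2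
    ≡⟨ sym (m≡m%n+[m/n]*n x 2) ⟩
  x ∎
  where
  open ≡-Reasoning
  rev′-1-bit : rev′ 1 (x % 2) ≡ x % 2
  rev′-1-bit = trans (+-identityʳ _) (trans (*-identityʳ _) (m%n%n≡m%n x 2))

rev<2^ : ∀ k x → rev k x < 2 ^ k
rev<2^ k x = subst (_< 2 ^ k) (sym (rev≡rev′ k x)) (rev′<2^ k x)

rev-involutive : ∀ k {x} → x < 2 ^ k → rev k (rev k x) ≡ x
rev-involutive k {x} x<2^k = begin
  rev k (rev k x)    ≡⟨ rev≡rev′ k _ ⟩
  rev′ k (rev k x)   ≡⟨ cong (rev′ k) (rev≡rev′ k x) ⟩
  rev′ k (rev′ k x)  ≡⟨ rev′-involutive k x<2^k ⟩
  x                  ∎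
  where open ≡-Reasoning

rev-split : ∀ {l k} q {r} → l ≤ k → r < 2 ^ l →
            rev k (q * 2 ^ l + r) ≡ rev (k ∸ l) q + 2 ^ (k ∸ l) * rev l r
rev-split {l} {k} q {r} l≤k r<2^l = begin
  rev k (q * 2 ^ l + r)
    ≡⟨ rev≡rev′ k _ ⟩
  rev′ k (q * 2 ^ l + r)
    ≡⟨ cong (λ n → rev′ n (q * 2 ^ l + r)) (sym (m+[n∸m]≡n l≤k)) ⟩
  rev′ (l + (k ∸ l)) (q * 2 ^ l + r)
    ≡⟨ rev′-split l (k ∸ l) q r<2^l ⟩
  rev′ (k ∸ l) q + 2 ^ (k ∸ l) * rev′ l r
    ≡⟨ sym (cong₂ (λ u v → u + 2 ^ (k ∸ l) * v) (rev≡rev′ (k ∸ l) q) (rev≡rev′ l r)) ⟩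
  rev (k ∸ l) q + 2 ^ (k ∸ l) * rev l r ∎
  where open ≡-Reasoning

rev-multiple : ∀ {l k} q → l ≤ k → rev k (q * 2 ^ l) ≡ rev (k ∸ l) q
rev-multiple {l} {k} q l≤k = begin
  rev k (q * 2 ^ l)                         ≡⟨ cong (rev k) (sym (+-identityʳ _)) ⟩
  rev k (q * 2 ^ l + 0)                     ≡⟨ rev-split q l≤k (m^n>0 2 l) ⟩
  rev (k ∸ l) q + 2 ^ (k ∸ l) * rev l 0     ≡⟨ cong (λ c → rev (k ∸ l) q + 2 ^ (k ∸ l) * c) rev-0 ⟩
  rev (k ∸ l) q + 2 ^ (k ∸ l) * 0           ≡⟨ cong (rev (k ∸ l) q +_) (*-zeroʳ (2 ^ (k ∸ l))) ⟩
  rev (k ∸ l) q + 0                         ≡⟨ +-identityʳ _ ⟩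
  rev (k ∸ l) q                             ∎
  where
  open ≡-Reasoning
  rev-0 : rev l 0 ≡ 0
  rev-0 = trans (rev≡rev′ l 0) (rev′-zero l)

rev-alignedBlock : ∀ {k l t} → l ≤ k → 2 ^ l ∣ t →
  ((y : ℕ) → Σ ℕ (λ x → ((t ≤ x) × (x ≤ t + 2 ^ l ∸ 1)) × (rev k x ≡ y)) ⇔
             Σ ℕ (λ x′ → (x′ ≤ 2 ^ l ∸ 1) × (rev k t + 2 ^ (k ∸ l) * x′ ≡ y)))
  × (rev k t < 2 ^ (k ∸ l))
rev-alignedBlock {k} {l} {t} l≤k (divides q refl) = (λ y → mk⇔ (reverse y) (enumerate y)) , bound
  where
  instance 2^l≢0 : NonZero (2 ^ l)
  2^l≢0 = m^n≢0 2 l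
  rev-offset : ∀ {r} → r < 2 ^ l → rev k (t + r) ≡ rev k t + 2 ^ (k ∸ l) * rev l r
  rev-offset {r} r<2^l = trans (rev-split q l≤k r<2^l)
                               (cong (_+ 2 ^ (k ∸ l) * rev l r) (sym (rev-multiple q l≤k)))
  bound : rev k t < 2 ^ (k ∸ l)
  bound = subst (_< 2 ^ (k ∸ l)) (sym (rev-multiple q l≤k)) (rev<2^ (k ∸ l) q)
  last≡ : t + 2 ^ l ∸ 1 ≡ t + pred (2 ^ l)
  last≡ = +-∸-assoc t (m^n>0 2 l)
  reverse : ∀ y → Σ ℕ (λ x → ((t ≤ x) × (x ≤ t + 2 ^ l ∸ 1)) × (rev k x ≡ y)) →
            Σ ℕ (λ x′ → (x′ ≤ 2 ^ l ∸ 1) × (rev k t + 2 ^ (k ∸ l) * x′ ≡ y))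
  reverse y (x , (t≤x , x≤last) , revx≡y) =
    rev l (x ∸ t) , <⇒≤pred (rev<2^ l (x ∸ t)) ,
    trans (sym (rev-offset offset<2^l)) (trans (cong (rev k) (m+[n∸m]≡n t≤x)) revx≡y)
    where
    offset<2^l : x ∸ t < 2 ^ l
    offset<2^l = m≤pred[n]⇒suc[m]≤n (m≤n+o⇒m∸n≤o x t (subst (x ≤_) last≡ x≤last))
  enumerate : ∀ y → Σ ℕ (λ x′ → (x′ ≤ 2 ^ l ∸ 1) × (rev k t + 2 ^ (k ∸ l) * x′ ≡ y)) →
              Σ ℕ (λ x → ((t ≤ x) × (x ≤ t + 2 ^ l ∸ 1)) × (rev k x ≡ y))
  enumerate y (x′ , x′≤pred , progression≡y) =
    t + rev l x′ , (m≤m+n t _ , subst (t + rev l x′ ≤_) (sym last≡) (+-monoʳ-≤ t (<⇒≤pred (rev<2^ l x′)))) ,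
    trans (rev-offset (rev<2^ l x′))
          (trans (cong (λ c → rev k t + 2 ^ (k ∸ l) * c) (rev-involutive l (m≤pred[n]⇒suc[m]≤n x′≤pred)))
                 progression≡y)

maxDiv≤ : ∀ b t → maxDiv b t ≤ b
maxDiv≤ zero    t = z≤n
maxDiv≤ (suc b) t with mod2^ t (suc b) ≟ 0
... | yes _ = ≤-refl
... | no  _ = m≤n⇒m≤1+n (maxDiv≤ b t)

2^maxDiv∣ : ∀ b t → 2 ^ maxDiv b t ∣ t
2^maxDiv∣ zero    t = divides t (sym (*-identityʳ t))
2^maxDiv∣ (suc b) t with mod2^ t (suc b) ≟ 0
... | yes t%2^1+b≡0 = m%n≡0⇒n∣m t (2 ^ suc b) {{m^n≢0 2 (suc b)}} t%2^1+b≡0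
... | no  _         = 2^maxDiv∣ b t

lemma1 : (k s : ℕ) → s ≤ 2 ^ k ∸ 1 → (m : ℕ) → IsLast k s m →
    (i : ℕ) → i ≤ m →
    ((y : ℕ) → InX k s i y ⇔
       Σ ℕ (λ x′ → (x′ ≤ 2 ^ ll k s i ∸ 1) ×
                   (rev k (tt k s i) + 2 ^ (k ∸ ll k s i) * x′ ≡ y)))
    × (rev k (tt k s i) < 2 ^ (k ∸ ll k s i))
lemma1 k s _ m _ i _ = rev-alignedBlock (maxDiv≤ k (tt k s i)) (2^maxDiv∣ k (tt k s i))
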